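{- Let $k\geq 3$ and let $G$ be a metric graph on $n$ vertices with $k$ dividing $n$. Let $H^*$ be a maximum weight Hamiltonian cycle of $G$ and $\mathcal{C}^*_k$ a maximum weight $k$-cycle packing of $G$. Then $w(H^*)\geq (1-0.5/k)\,w(\mathcal{C}^*_k)$.
   Context: A metric graph is an undirected complete graph $G=(V,E)$ with a non-negative edge weight function $w$ satisfying the triangle inequality; for an edge set $Y$, $w(Y)=\sum_{e\in Y}w(e)$, and the weight of a cycle or collection of cycles is the total weight of its edges. A $k$-cycle is a simple cycle on exactly $k$ distinct vertices; a $k$-cycle packing is a set of $n/k$ vertex-disjoint $k$-cycles covering all vertices.
   Formalization: The edge weights of the metric graph take values in the non-negative rationals rather than the non-negative reals. -}

module Defs where

open import Data.Nat using (ℕ; zero; suc)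
open import Data.Fin using (Fin; zero; suc)
open import Data.Product using (_×_; _,_)
open import Data.Rational using (ℚ; 0ℚ; _+_; _≤_)
open import Relation.Binary.PropositionalEquality using (_≡_)
open import Relation.Nullary using (¬_)
open import Function.Bundles using (_⤖_; Bijection)
open import Data.Nat.Divisibility using (_∣_)
open _∣_ using (quotient)

Σ : ∀ {n} → (Fin n → ℚ) → ℚ
Σ {zero}  f = 0ℚ
Σ {suc n} f = f zero + Σ (λ i → f (suc i))

-- Cyclic successor on Fin n: i ↦ i + 1 mod n (last element ↦ zero).
next : ∀ {n} → Fin n → Fin n
next {suc zero}    zero    = zero
next {suc (suc n)} zero    = suc zero
next {suc (suc n)} (suc i) with next {suc n} i
... | zero  = zero
... | suc j = suc (suc j)

-- Edge weights on the complete graph with vertex set Fin n.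
Weight : ℕ → Set
Weight n = Fin n → Fin n → ℚ

-- Metric graph: non-negative, symmetric weights satisfying the triangle
-- inequality (edges join distinct vertices, so only distinct triples matter).
record IsMetric {n : ℕ} (w : Weight n) : Set where
  field
    nonneg    : ∀ i j → ¬ i ≡ j → 0ℚ ≤ w i j
    symmetric : ∀ i j → w i j ≡ w j i
    triangle  : ∀ i j l → ¬ i ≡ j → ¬ j ≡ l → ¬ i ≡ l →
                w i l ≤ w i j + w j l

-- A Hamiltonian cycle, given as a cyclic ordering of all vertices:
-- σ 0, σ 1, …, σ (n-1), σ 0.
HamCycle : ℕ → Set
HamCycle n = Fin n ⤖ Fin n

hamWeight : ∀ {n} → Weight n → HamCycle n → ℚ
hamWeight w σ = Σ (λ i → w (to i) (to (next i)))
  where open Bijection σ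

-- A k-cycle packing of Fin n (k ∣ n): n/k vertex-disjoint k-cycles covering
-- all vertices; cycle j is f(j,0), f(j,1), …, f(j,k-1), f(j,0).  Disjointness
-- and covering are exactly bijectivity of f.
Packing : (n k : ℕ) → k ∣ n → Set
Packing n k k∣n = (Fin (quotient k∣n) × Fin k) ⤖ Fin n

packWeight : ∀ {n k} (k∣n : k ∣ n) → Weight n → Packing n k k∣n → ℚ
packWeight k∣n w f =
  Σ (λ j → Σ (λ i → w (to (j , i)) (to (j , next i))))
  where open Bijection f

{-# OPTIONS --safe #-}
module Submission where

-- Rotate each cycle of a packing so that its lightest edge is the closing edge from its last
-- vertex back to its first, and reorder the cycles so that the first one has the heaviest
-- closing edge.  Deleting the closing edges leaves paths of total weight w(C) − Σc, where
-- Σc ≤ w(C)/k because each closing edge is at most the mean edge of its cycle.  Concatenating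
-- the paths, each traversed in a chosen direction, gives a Hamiltonian cycle.  By the triangle
-- inequality, the two ways of joining a fixed vertex to a path weigh together at least the
-- path's closing edge, so choosing directions backwards from the last path makes each join
-- weigh at least half the closing edge of the path it leaves; the direction of the first path
-- is chosen last, against both of its joins, which then weigh at least its closing edge; as that
-- is the heaviest closing edge, this also pays for the last path.  Hence
-- w(H) ≥ w(C) − Σc/2 ≥ (1 − 1/(2k)) w(C).

open import Defs
import Data.Rational.Properties as ℚₚ
open import Algebra.Bundles using (CommutativeRing)
open import Algebra.Properties.Semiring.Sum (CommutativeRing.semiring ℚₚ.+-*-commutativeRing)
  using (sum; sum-syntax; sum-cong-≗; sum-init-last; ∑-distrib-+; ∑-permute; *-distribˡ-sum; *-distribʳ-sum)
open import Relation.Binary.Bundles using (DecTotalOrder)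
open import Data.Bool.Base using (Bool; true; false; not)
open import Data.Empty using (⊥-elim)
open import Data.Fin.Base using (Fin; zero; suc; toℕ; fromℕ; inject₁; opposite; combine; remQuot; _↑ˡ_; _↑ʳ_)
open import Data.Fin.Permutation as Perm using (Permutation′; _⟨$⟩ʳ_; _⟨$⟩ˡ_; _∘ₚ_)
open import Data.Fin.Properties
  using ( toℕ-injective; toℕ-inject₁; toℕ-fromℕ; toℕ<n; toℕ-combine; remQuot-combine; suc-injective
        ; 0≢1+n; *↔×)
open import Data.Fin.Relation.Unary.Top using (view; ‵fromℕ; ‵inject₁)
import Data.Integer.Base as ℤ
open import Data.Integer.Base using (+_)
import Data.Integer.Properties as ℤₚ
import Data.Integer.Tactic.RingSolver as ℤ-Solver
open import Data.List.Base using (allFin)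
import Data.List.Extrema (DecTotalOrder.totalOrder ℚₚ.≤-decTotalOrder) as Extrema
open import Data.List.Membership.Propositional.Properties using (∈-allFin)
import Data.List.Relation.Unary.All as All
open import Data.Nat.Base as ℕ using (ℕ; zero; suc; _≤_; NonZero; s≤s)
import Data.Nat.Properties as ℕₚ
open import Data.Nat.Divisibility using (_∣_; divides)
open import Data.Nat.Tactic.RingSolver using (solve-∀)
open import Data.Product.Base using (_×_; _,_; proj₁; proj₂; uncurry; ∃-syntax; Σ-syntax)
open import Data.Product.Properties using (,-injectiveˡ; ,-injectiveʳ)
open import Data.Rational using (ℚ; 0ℚ; 1ℚ; ½; _+_; _-_; _*_; _/_; NonNegative; toℚᵘ)
  renaming (_≤_ to _≤ℚ_)
open import Data.Rational.Solver using (module +-*-Solver)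
import Data.Rational.Unnormalised.Base as ℚᵘ
import Data.Rational.Unnormalised.Properties as ℚᵘₚ
open import Data.Sum.Base using (inj₁; inj₂)
open import Data.Vec.Functional using (_∷_)
open import Function.Base using (_∘_)
open import Function.Bundles using (_⤖_; Bijection; mk↔ₛ′)
open import Function.Construct.Composition using (_⤖-∘_)
open import Function.Properties.Inverse using (↔⇒⤖)
open import Relation.Binary.PropositionalEquality

private
  variable
    A : Set
    m n p q : ℕ

Σ≡sum : (f : Fin n → ℚ) → Σ f ≡ sum f
Σ≡sum {zero}  f = refl
Σ≡sum {suc n} f = cong (_+_ (f zero)) (Σ≡sum (f ∘ suc))

sum-mono-≤ : {f g : Fin n → ℚ} → (∀ i → f i ≤ℚ g i) → sum f ≤ℚ sum g
sum-mono-≤ {zero}  f≤g = ℚₚ.≤-refl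
sum-mono-≤ {suc n} f≤g = ℚₚ.+-mono-≤ (f≤g zero) (sum-mono-≤ (f≤g ∘ suc))

sum-↑ˡ-↑ʳ : ∀ m (f : Fin (m ℕ.+ n) → ℚ) → sum f ≡ ∑[ i < m ] f (i ↑ˡ n) + ∑[ i < n ] f (m ↑ʳ i)
sum-↑ˡ-↑ʳ         zero    f = sym (ℚₚ.+-identityˡ _)
sum-↑ˡ-↑ʳ {n = n} (suc m) f = trans (cong (_+_ (f zero)) (sum-↑ˡ-↑ʳ m (f ∘ suc)))
  (sym (ℚₚ.+-assoc (f zero) (∑[ i < m ] f (suc (i ↑ˡ n))) (∑[ i < n ] f (suc (m ↑ʳ i)))))

sum-combine : ∀ q (f : Fin (q ℕ.* n) → ℚ) → sum f ≡ ∑[ j < q ] ∑[ i < n ] f (combine j i)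
sum-combine         zero    f = refl
sum-combine {n = n} (suc q) f =
  trans (sum-↑ˡ-↑ʳ n f) (cong (_+_ (∑[ i < n ] f (i ↑ˡ _))) (sum-combine q (f ∘ (n ↑ʳ_))))

½*-≤ : ∀ {c t} → c ≤ℚ t + t → ½ * c ≤ℚ t
½*-≤ {c} {t} c≤2t = ℚₚ.≤-trans (ℚₚ.*-monoˡ-≤-nonNeg ½ c≤2t) (ℚₚ.≤-reflexive (half-double t))
  where
  open +-*-Solver
  half-double : ∀ t → ½ * (t + t) ≡ t
  half-double = solve 1 (λ t → con ½ :* (t :+ t) := t) refl

½*-≤-self : ∀ {c} → 0ℚ ≤ℚ c → ½ * c ≤ℚ c
½*-≤-self {c} 0≤c =
  ½*-≤ (ℚₚ.≤-trans (ℚₚ.≤-reflexive (sym (ℚₚ.+-identityʳ c))) (ℚₚ.+-monoʳ-≤ c 0≤c))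

averaging : (f : Bool → ℚ) {c : ℚ} → c ≤ℚ f true + f false → ∃[ t ] ½ * c ≤ℚ f t
averaging f c≤ with ℚₚ.≤-total (f false) (f true)
... | inj₁ f₀≤f₁ = true  , ½*-≤ (ℚₚ.≤-trans c≤ (ℚₚ.+-monoʳ-≤ (f true) f₀≤f₁))
... | inj₂ f₁≤f₀ = false , ½*-≤ (ℚₚ.≤-trans c≤ (ℚₚ.+-monoˡ-≤ (f false) f₁≤f₀))

-- In ℚᵘ the fractions n / (1 + d) stay unnormalised, so the partial sums are computed there.
∑-reciprocal : ∀ d → ∑[ i < suc d ] (+ 1 / suc d) ≡ 1ℚ
∑-reciprocal d =
  ℚₚ.toℚᵘ-injective (ℚᵘₚ.≃-trans (partial (suc d)) (ℚᵘ.*≡* (ℤₚ.*-comm (+ suc d) (+ 1))))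
  where
  partial : ∀ n → toℚᵘ (∑[ i < n ] (+ 1 / suc d)) ℚᵘ.≃ ℚᵘ.mkℚᵘ (+ n) d
  partial zero    = ℚᵘ.*≡* refl
  partial (suc n) = ℚᵘₚ.≃-trans (ℚₚ.toℚᵘ-homo-+ (+ 1 / suc d) _)
    (ℚᵘₚ.≃-trans (ℚᵘₚ.+-cong (ℚₚ.toℚᵘ-fromℚᵘ (ℚᵘ.mkℚᵘ (+ 1) d)) (partial n))
                 (ℚᵘ.*≡* (arithmetic (+ n) (+ suc d))))
    where
    arithmetic : ∀ (n k : ℤ.ℤ) → (+ 1 ℤ.* k ℤ.+ n ℤ.* k) ℤ.* k ≡ (+ 1 ℤ.+ n) ℤ.* (k ℤ.* k)
    arithmetic = ℤ-Solver.solve-∀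

≤-mean : ∀ {d c} (f : Fin (suc d) → ℚ) → (∀ i → c ≤ℚ f i) → c ≤ℚ (+ 1 / suc d) * sum f
≤-mean {d} {c} f c≤f = begin
  c                           ≡⟨ ℚₚ.*-identityˡ c ⟨
  1ℚ * c                      ≡⟨ cong (_* c) (∑-reciprocal d) ⟨
  (∑[ i < suc d ] κ) * c      ≡⟨ *-distribʳ-sum {suc d} c (λ _ → κ) ⟩
  ∑[ i < suc d ] (κ * c)      ≤⟨ sum-mono-≤ (λ i → ℚₚ.*-monoˡ-≤-nonNeg κ (c≤f i)) ⟩
  ∑[ i < suc d ] (κ * f i)    ≡⟨ *-distribˡ-sum κ f ⟨
  κ * sum f                   ∎
  where
  open ℚₚ.≤-Reasoning
  κ : ℚ
  κ = + 1 / suc d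
  instance
    κ-nonNeg : NonNegative κ
    κ-nonNeg = ℚₚ.normalize-nonNeg 1 (suc d)

half-loss-bound : ∀ {a c κ} → c ≤ℚ κ * (a + c) → (1ℚ - ½ * κ) * (a + c) ≤ℚ a + ½ * c
half-loss-bound {a} {c} {κ} c≤κ[a+c] = begin
  (1ℚ - ½ * κ) * (a + c)       ≡⟨ distribute a c κ ⟩
  (a + c) - ½ * (κ * (a + c))  ≤⟨ ℚₚ.+-monoʳ-≤ (a + c)
                                    (ℚₚ.neg-antimono-≤ (ℚₚ.*-monoˡ-≤-nonNeg ½ c≤κ[a+c])) ⟩
  (a + c) - ½ * c              ≡⟨ halve a c ⟩
  a + ½ * c                    ∎
  where
  open ℚₚ.≤-Reasoning
  open +-*-Solver
  distribute : ∀ a c κ → (1ℚ - ½ * κ) * (a + c) ≡ (a + c) - ½ * (κ * (a + c))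
  distribute = solve 3 (λ a c κ → (con 1ℚ :- con ½ :* κ) :* (a :+ c)
                                  := (a :+ c) :- con ½ :* (κ :* (a :+ c))) refl
  halve : ∀ a c → (a + c) - ½ * c ≡ a + ½ * c
  halve = solve 2 (λ a c → (a :+ c) :- con ½ :* c := a :+ con ½ :* c) refl

minimiser : (f : Fin (suc n) → ℚ) → ∃[ i ] ∀ j → f i ≤ℚ f j
minimiser f = Extrema.argmin f zero (allFin _) ,
              λ j → All.lookup (Extrema.f[argmin]≤f[xs] {f = f} zero (allFin _)) (∈-allFin j)

maximiser : (f : Fin (suc n) → ℚ) → ∃[ i ] ∀ j → f j ≤ℚ f i
maximiser f = Extrema.argmax f zero (allFin _) ,
              λ j → All.lookup (Extrema.f[xs]≤f[argmax] {f = f} zero (allFin _)) (∈-allFin j)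

next-fromℕ : ∀ n → next (fromℕ n) ≡ zero
next-fromℕ zero    = refl
next-fromℕ (suc n) rewrite next-fromℕ n = refl

next-inject₁ : (i : Fin n) → next (inject₁ i) ≡ suc i
next-inject₁ {suc zero}    zero    = refl
next-inject₁ {suc (suc n)} zero    = refl
next-inject₁ {suc (suc n)} (suc i) rewrite next-inject₁ i = refl

next-via-toℕ : {i j : Fin (suc n)} → suc (toℕ i) ≡ toℕ j → next i ≡ j
next-via-toℕ {n} {i} {j} eq with view i
... | ‵fromℕ     =
  ⊥-elim (ℕₚ.<⇒≱ (toℕ<n j) (ℕₚ.≤-reflexive (trans (cong suc (sym (toℕ-fromℕ n))) eq)))
... | ‵inject₁ k = trans (next-inject₁ k) (toℕ-injective (trans (cong suc (sym (toℕ-inject₁ k))) eq))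

sum-next : (F : Fin (suc n) → Fin (suc n) → ℚ) →
           ∑[ i < suc n ] F i (next i) ≡ ∑[ i < n ] F (inject₁ i) (suc i) + F (fromℕ n) zero
sum-next {n} F = trans (sum-init-last (λ i → F i (next i)))
  (cong₂ _+_ (sum-cong-≗ (λ i → cong (F (inject₁ i)) (next-inject₁ i)))
             (cong (F (fromℕ n)) (next-fromℕ n)))

next-combine-inject₁ : (j : Fin (suc p)) (i : Fin n) → next (combine j (inject₁ i)) ≡ combine j (suc i)
next-combine-inject₁ {n = n} j i = next-via-toℕ (begin
  suc (toℕ (combine j (inject₁ i)))          ≡⟨ cong suc (toℕ-combine j (inject₁ i)) ⟩
  suc (suc n ℕ.* toℕ j ℕ.+ toℕ (inject₁ i))  ≡⟨ cong (λ t → suc (suc n ℕ.* toℕ j ℕ.+ t))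
                                                     (toℕ-inject₁ i) ⟩
  suc (suc n ℕ.* toℕ j ℕ.+ toℕ i)            ≡⟨ ℕₚ.+-suc (suc n ℕ.* toℕ j) (toℕ i) ⟨
  suc n ℕ.* toℕ j ℕ.+ suc (toℕ i)            ≡⟨ toℕ-combine j (suc i) ⟨
  toℕ (combine j (suc i))                    ∎)
  where open ≡-Reasoning

next-combine-fromℕ : (j : Fin (suc p)) → next (combine j (fromℕ n)) ≡ combine (next j) zero
next-combine-fromℕ {p} {n} j with view j
... | ‵fromℕ = begin
  next (combine (fromℕ p) (fromℕ n))  ≡⟨ cong next (toℕ-injective toℕ-top) ⟩
  next (fromℕ (n ℕ.+ p ℕ.* suc n))    ≡⟨ next-fromℕ _ ⟩
  zero                                ≡⟨ cong (λ j → combine j zero) (next-fromℕ p) ⟨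
  combine (next (fromℕ p)) zero       ∎
  where
  open ≡-Reasoning
  arithmetic : ∀ p n → suc n ℕ.* p ℕ.+ n ≡ n ℕ.+ p ℕ.* suc n
  arithmetic = solve-∀
  toℕ-top : toℕ (combine (fromℕ p) (fromℕ n)) ≡ toℕ (fromℕ (n ℕ.+ p ℕ.* suc n))
  toℕ-top = begin
    toℕ (combine (fromℕ p) (fromℕ n))          ≡⟨ toℕ-combine (fromℕ p) (fromℕ n) ⟩
    suc n ℕ.* toℕ (fromℕ p) ℕ.+ toℕ (fromℕ n)  ≡⟨ cong₂ (λ a b → suc n ℕ.* a ℕ.+ b)
                                                        (toℕ-fromℕ p) (toℕ-fromℕ n) ⟩
    suc n ℕ.* p ℕ.+ n                          ≡⟨ arithmetic p n ⟩
    n ℕ.+ p ℕ.* suc n                          ≡⟨ toℕ-fromℕ _ ⟨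
    toℕ (fromℕ (n ℕ.+ p ℕ.* suc n))            ∎
... | ‵inject₁ k = trans (next-via-toℕ toℕ-step) (cong (λ j → combine j zero) (sym (next-inject₁ k)))
  where
  open ≡-Reasoning
  arithmetic : ∀ a n → suc (suc n ℕ.* a ℕ.+ n) ≡ suc n ℕ.* suc a ℕ.+ 0
  arithmetic = solve-∀
  toℕ-step : suc (toℕ (combine (inject₁ k) (fromℕ n))) ≡ toℕ (combine (suc k) (zero {n}))
  toℕ-step = begin
    suc (toℕ (combine (inject₁ k) (fromℕ n)))          ≡⟨ cong suc (toℕ-combine (inject₁ k) (fromℕ n)) ⟩
    suc (suc n ℕ.* toℕ (inject₁ k) ℕ.+ toℕ (fromℕ n))  ≡⟨ cong₂ (λ a b → suc (suc n ℕ.* a ℕ.+ b))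
                                                                (toℕ-inject₁ k) (toℕ-fromℕ n) ⟩
    suc (suc n ℕ.* toℕ k ℕ.+ n)                        ≡⟨ arithmetic (toℕ k) n ⟩
    suc n ℕ.* suc (toℕ k) ℕ.+ 0                        ≡⟨ toℕ-combine (suc k) zero ⟨
    toℕ (combine (suc k) (zero {n}))                   ∎

-- Rotations and reversals of a cyclic order

prev : Fin (suc n) → Fin (suc n)
prev zero    = fromℕ _
prev (suc i) = inject₁ i

next-prev : (i : Fin (suc n)) → next (prev i) ≡ i
next-prev zero    = next-fromℕ _
next-prev (suc i) = next-inject₁ i

prev-next : (i : Fin (suc n)) → prev (next i) ≡ i
prev-next i with view i
... | ‵fromℕ     = cong prev (next-fromℕ _)
... | ‵inject₁ k = cong prev (next-inject₁ k)

nextₚ : Permutation′ (suc n)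
nextₚ = Perm.permutation next prev next-prev prev-next

rotation : ℕ → Permutation′ (suc n)
rotation zero    = Perm.id
rotation (suc r) = rotation r ∘ₚ nextₚ

rotation-next : ∀ r (i : Fin (suc n)) → rotation r ⟨$⟩ʳ next i ≡ next (rotation r ⟨$⟩ʳ i)
rotation-next zero    i = refl
rotation-next (suc r) i = cong next (rotation-next r i)

rotation-zero : ∀ r (i : Fin (suc n)) → toℕ i ≡ r → rotation r ⟨$⟩ʳ zero ≡ i
rotation-zero zero    zero    _  = refl
rotation-zero zero    (suc i) ()
rotation-zero (suc r) zero    ()
rotation-zero (suc r) (suc i) eq = trans
  (cong next (rotation-zero r (inject₁ i) (trans (toℕ-inject₁ i) (ℕₚ.suc-injective eq))))
  (next-inject₁ i)

rotation-fromℕ : (i : Fin (suc n)) → rotation (suc (toℕ i)) ⟨$⟩ʳ fromℕ n ≡ i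
rotation-fromℕ {n} i = begin
  next (rotation (toℕ i) ⟨$⟩ʳ fromℕ n)  ≡⟨ rotation-next (toℕ i) (fromℕ n) ⟨
  rotation (toℕ i) ⟨$⟩ʳ next (fromℕ n)  ≡⟨ cong (rotation (toℕ i) ⟨$⟩ʳ_) (next-fromℕ n) ⟩
  rotation (toℕ i) ⟨$⟩ʳ zero            ≡⟨ rotation-zero (toℕ i) i refl ⟩
  i                                     ∎
  where open ≡-Reasoning

opposite-inject₁ : (i : Fin n) → opposite (inject₁ i) ≡ suc (opposite i)
opposite-inject₁ zero    = refl
opposite-inject₁ (suc i) = cong inject₁ (opposite-inject₁ i)

opposite-fromℕ : ∀ n → opposite (fromℕ n) ≡ zero
opposite-fromℕ zero    = refl
opposite-fromℕ (suc n) = cong inject₁ (opposite-fromℕ n)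

orient : Bool → Permutation′ n
orient true  = Perm.id
orient false = Perm.reverse

endpoint : Bool → Fin (suc n)
endpoint true  = fromℕ _
endpoint false = zero

orient-fromℕ : ∀ b → orient b ⟨$⟩ʳ fromℕ n ≡ endpoint b
orient-fromℕ true  = refl
orient-fromℕ false = opposite-fromℕ _

orient-zero : ∀ b → orient b ⟨$⟩ʳ zero {n} ≡ endpoint (not b)
orient-zero true  = refl
orient-zero false = refl

-- Cycle covers

CycleCover : ℕ → ℕ → Set → Set
CycleCover q n A = (Fin q × Fin n) ⤖ A

cycle : CycleCover q n A → Fin q → Fin n → A
cycle C j i = Bijection.to C (j , i)

ends : CycleCover q (suc n) A → Fin q → Bool → A
ends C j t = cycle C j (endpoint t)

concat : (Fin q → Fin n → A) → Fin (q ℕ.* n) → A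
concat {n = n} x t = uncurry x (remQuot n t)

concatenate : CycleCover q n A → Fin (q ℕ.* n) ⤖ A
concatenate C = C ⤖-∘ ↔⇒⤖ *↔×

rotateEach : (Fin q → Permutation′ n) → CycleCover q n A → CycleCover q n A
rotateEach {q = q} {n = n} ρ C =
  C ⤖-∘ ↔⇒⤖ (mk↔ₛ′ to from (λ (j , i) → cong (j ,_) (Perm.inverseʳ (ρ j)))
                           (λ (j , i) → cong (j ,_) (Perm.inverseˡ (ρ j))))
  where
  to from : Fin q × Fin n → Fin q × Fin n
  to   (j , i) = j , ρ j ⟨$⟩ʳ i
  from (j , i) = j , ρ j ⟨$⟩ˡ i

permuteCycles : Permutation′ q → CycleCover q n A → CycleCover q n A
permuteCycles {q = q} {n = n} π C =
  C ⤖-∘ ↔⇒⤖ (mk↔ₛ′ to from (λ (j , i) → cong (_, i) (Perm.inverseʳ π))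
                           (λ (j , i) → cong (_, i) (Perm.inverseˡ π)))
  where
  to from : Fin q × Fin n → Fin q × Fin n
  to   (j , i) = π ⟨$⟩ʳ j , i
  from (j , i) = π ⟨$⟩ˡ j , i

module _ (w : A → A → ℚ) where

  edgeWeight : (Fin n → A) → Fin n → ℚ
  edgeWeight x i = w (x i) (x (next i))

  cycleWeight : (Fin n → A) → ℚ
  cycleWeight x = sum (edgeWeight x)

  pathWeight : (Fin (suc n) → A) → ℚ
  pathWeight {n} x = ∑[ i < n ] w (x (inject₁ i)) (x (suc i))

  closingWeight : (Fin (suc n) → A) → ℚ
  closingWeight {n} x = w (x (fromℕ n)) (x zero)

  coverWeight : CycleCover q n A → ℚ
  coverWeight C = ∑[ j < _ ] cycleWeight (cycle C j)

  cycleWeight-split : (x : Fin (suc n) → A) → cycleWeight x ≡ pathWeight x + closingWeight x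
  cycleWeight-split x = sum-next (λ i j → w (x i) (x j))

  edgeWeight-rotation : ∀ r (x : Fin (suc n) → A) i →
                        edgeWeight (x ∘ (rotation r ⟨$⟩ʳ_)) i ≡ edgeWeight x (rotation r ⟨$⟩ʳ i)
  edgeWeight-rotation r x i = cong (w (x (rotation r ⟨$⟩ʳ i)) ∘ x) (rotation-next r i)

  cycleWeight-rotation : ∀ r (x : Fin (suc n) → A) → cycleWeight (x ∘ (rotation r ⟨$⟩ʳ_)) ≡ cycleWeight x
  cycleWeight-rotation r x =
    trans (sum-cong-≗ (edgeWeight-rotation r x)) (sym (∑-permute (edgeWeight x) (rotation r)))

  closingWeight-rotation : ∀ r (x : Fin (suc n) → A) →
                           closingWeight (x ∘ (rotation r ⟨$⟩ʳ_)) ≡ edgeWeight x (rotation r ⟨$⟩ʳ fromℕ n)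
  closingWeight-rotation {n} r x = cong (w (x (rotation r ⟨$⟩ʳ fromℕ n)) ∘ x) (begin
    rotation r ⟨$⟩ʳ zero            ≡⟨ cong (rotation r ⟨$⟩ʳ_) (next-fromℕ n) ⟨
    rotation r ⟨$⟩ʳ next (fromℕ n)  ≡⟨ rotation-next r (fromℕ n) ⟩
    next (rotation r ⟨$⟩ʳ fromℕ n)  ∎)
    where open ≡-Reasoning

  pathWeight-reverse : (∀ a b → w a b ≡ w b a) → (x : Fin (suc n) → A) →
                       pathWeight (x ∘ opposite) ≡ pathWeight x
  pathWeight-reverse {n} w-sym x = begin
    ∑[ i < n ] w (x (opposite (inject₁ i))) (x (inject₁ (opposite i)))
      ≡⟨ sum-cong-≗ (λ i → trans (cong (λ k → w (x k) (x (inject₁ (opposite i)))) (opposite-inject₁ i))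
                                 (w-sym _ _)) ⟩
    ∑[ i < n ] w (x (inject₁ (opposite i))) (x (suc (opposite i)))
      ≡⟨ ∑-permute (λ i → w (x (inject₁ i)) (x (suc i))) Perm.reverse ⟨
    pathWeight x ∎
    where open ≡-Reasoning

  pathWeight-orient : (∀ a b → w a b ≡ w b a) → ∀ b (x : Fin (suc n) → A) →
                      pathWeight (x ∘ (orient b ⟨$⟩ʳ_)) ≡ pathWeight x
  pathWeight-orient w-sym true  x = refl
  pathWeight-orient w-sym false x = pathWeight-reverse w-sym x

  cycleWeight-concat : (x : Fin (suc p) → Fin (suc n) → A) →
    cycleWeight (concat x) ≡ ∑[ j < suc p ] (pathWeight (x j) + w (x j (fromℕ n)) (x (next j) zero))
  cycleWeight-concat {p} {n} x = trans (sum-combine (suc p) (edgeWeight (concat x))) (sum-cong-≗ block)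
    where
    concat-combine : ∀ j i → concat x (combine j i) ≡ x j i
    concat-combine j i = cong (uncurry x) (remQuot-combine j i)

    block : ∀ j → ∑[ i < suc n ] edgeWeight (concat x) (combine j i)
                  ≡ pathWeight (x j) + w (x j (fromℕ n)) (x (next j) zero)
    block j = trans (sum-init-last (edgeWeight (concat x) ∘ combine j)) (cong₂ _+_
      (sum-cong-≗ (λ i → cong₂ w (concat-combine j (inject₁ i))
                         (trans (cong (concat x) (next-combine-inject₁ j i)) (concat-combine j (suc i)))))
      (cong₂ w (concat-combine j (fromℕ n))
               (trans (cong (concat x) (next-combine-fromℕ j)) (concat-combine (next j) zero))))

  record IsNormal (C : CycleCover (suc p) (suc n) A) : Set where
    field
      closing-lightest       : ∀ j i → closingWeight (cycle C j) ≤ℚ edgeWeight (cycle C j) i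
      closing-heaviest-first : ∀ j → closingWeight (cycle C j) ≤ℚ closingWeight (cycle C zero)

  rotate-lightest-closing : (C : CycleCover q (suc n) A) →
    ∃[ C′ ] coverWeight C′ ≡ coverWeight C ×
            (∀ j i → closingWeight (cycle C′ j) ≤ℚ edgeWeight (cycle C′ j) i)
  rotate-lightest-closing {n = n} C =
    rotateEach (rotation ∘ shift) C , sum-cong-≗ (λ j → cycleWeight-rotation (shift j) (cycle C j)) , lightest
    where
    lightest-edge : ∀ j → ∃[ i ] ∀ i′ → edgeWeight (cycle C j) i ≤ℚ edgeWeight (cycle C j) i′
    lightest-edge j = minimiser (edgeWeight (cycle C j))

    shift : Fin _ → ℕ
    shift j = suc (toℕ (proj₁ (lightest-edge j)))

    lightest : ∀ j i → closingWeight (cycle C j ∘ (rotation (shift j) ⟨$⟩ʳ_))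
                       ≤ℚ edgeWeight (cycle C j ∘ (rotation (shift j) ⟨$⟩ʳ_)) i
    lightest j i = begin
      closingWeight (x ∘ (ρ ⟨$⟩ʳ_))  ≡⟨ closingWeight-rotation (shift j) x ⟩
      edgeWeight x (ρ ⟨$⟩ʳ fromℕ n)  ≡⟨ cong (edgeWeight x) (rotation-fromℕ e) ⟩
      edgeWeight x e                 ≤⟨ proj₂ (lightest-edge j) (ρ ⟨$⟩ʳ i) ⟩
      edgeWeight x (ρ ⟨$⟩ʳ i)        ≡⟨ edgeWeight-rotation (shift j) x i ⟨
      edgeWeight (x ∘ (ρ ⟨$⟩ʳ_)) i   ∎
      where
      open ℚₚ.≤-Reasoning
      x : Fin (suc n) → A
      x = cycle C j
      e : Fin (suc n)
      e = proj₁ (lightest-edge j)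
      ρ : Permutation′ (suc n)
      ρ = rotation (shift j)

  permute-heaviest-first : (C : CycleCover (suc p) (suc n) A) →
    (∀ j i → closingWeight (cycle C j) ≤ℚ edgeWeight (cycle C j) i) →
    ∃[ C′ ] coverWeight C′ ≡ coverWeight C × IsNormal C′
  permute-heaviest-first C lightest =
    permuteCycles π C , sym (∑-permute (cycleWeight ∘ cycle C) π) , normal
    where
    heaviest : ∃[ M ] ∀ j → closingWeight (cycle C j) ≤ℚ closingWeight (cycle C M)
    heaviest = maximiser (closingWeight ∘ cycle C)

    π : Permutation′ _
    π = Perm.transpose zero (proj₁ heaviest)

    normal : IsNormal (permuteCycles π C)
    normal = record { closing-lightest       = lightest ∘ (π ⟨$⟩ʳ_)
                    ; closing-heaviest-first = proj₂ heaviest ∘ (π ⟨$⟩ʳ_) }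

  normalise : (C : CycleCover (suc p) (suc n) A) → ∃[ C′ ] coverWeight C′ ≡ coverWeight C × IsNormal C′
  normalise C =
    let (C₁ , same₁ , lightest) = rotate-lightest-closing C
        (C₂ , same₂ , normal)   = permute-heaviest-first C₁ lightest
    in C₂ , trans same₂ same₁ , normal

-- Orienting a cyclic sequence of paths

module Orientation {V : Set} (w : V → V → ℚ) (w-sym : ∀ a b → w a b ≡ w b a) where

  -- e j t is the endpoint at which path j is left when it is traversed with orientation t;
  -- it is then entered at e j (not t).

  closing : (Fin q → Bool → V) → Fin q → ℚ
  closing e j = w (e j true) (e j false)

  link : (Fin q → Bool → V) → (Fin q → Bool) → Fin q → Fin q → ℚ
  link e s j j′ = w (e j (s j)) (e j′ (not (s j′)))

  joins : (Fin q → Bool → V) → Fin q → V → V → Bool → ℚ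
  joins e j x y t = w (e j t) y + w x (e j (not t))

  DetourBound : (Fin q → Bool → V) → Set
  DetourBound e = ∀ {j j′} → j ≢ j′ → ∀ t →
                  closing e j ≤ℚ w (e j true) (e j′ t) + w (e j false) (e j′ t)

  DetourBound-suc : {e : Fin (suc q) → Bool → V} → DetourBound e → DetourBound (e ∘ suc)
  DetourBound-suc detour j≢j′ = detour (j≢j′ ∘ suc-injective)

  joins-detour : {e : Fin q → Bool → V} → DetourBound e → ∀ {j j′ j″} → j ≢ j′ → j ≢ j″ → ∀ t′ t″ →
    closing e j + closing e j ≤ℚ joins e j (e j″ t″) (e j′ t′) true + joins e j (e j″ t″) (e j′ t′) false
  joins-detour {e = e} detour {j} {j′} {j″} j≢j′ j≢j″ t′ t″ = begin
    closing e j + closing e j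
      ≤⟨ ℚₚ.+-mono-≤ (detour j≢j′ t′) (detour j≢j″ t″) ⟩
    (w (e j true) y + w (e j false) y) + (w (e j true) x + w (e j false) x)
      ≡⟨ cong₂ (λ u v → (w (e j true) y + w (e j false) y) + (u + v)) (w-sym _ _) (w-sym _ _) ⟩
    (w (e j true) y + w (e j false) y) + (w x (e j true) + w x (e j false))
      ≡⟨ interchange (w (e j true) y) (w (e j false) y) (w x (e j true)) (w x (e j false)) ⟩
    joins e j x y true + joins e j x y false ∎
    where
    open ℚₚ.≤-Reasoning
    open +-*-Solver
    x y : V
    x = e j″ t″
    y = e j′ t′
    interchange : ∀ a b c d → (a + b) + (c + d) ≡ (a + d) + (b + c)
    interchange = solve 4 (λ a b c d → (a :+ b) :+ (c :+ d) := (a :+ d) :+ (b :+ c)) refl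

  chain-orientation : (e : Fin (suc q) → Bool → V) → DetourBound e →
    ∃[ s ] ½ * ∑[ i < q ] closing e (inject₁ i) ≤ℚ ∑[ i < q ] link e s (inject₁ i) (suc i)
  chain-orientation {zero}  e _      = (λ _ → true) , ℚₚ.≤-reflexive (ℚₚ.*-zeroʳ ½)
  chain-orientation {suc q} e detour =
    let (s , ½rest≤links) = chain-orientation (e ∘ suc) (DetourBound-suc detour)
        y                 = e (suc zero) (not (s zero))
        (t , ½c₀≤link)    = averaging (λ t → w (e zero t) y) (detour {zero} {suc zero} (λ ()) (not (s zero)))
    in t ∷ s , ℚₚ.≤-trans (ℚₚ.≤-reflexive (ℚₚ.*-distribˡ-+ ½ (closing e zero) _))
                          (ℚₚ.+-mono-≤ ½c₀≤link ½rest≤links)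

  extend-to-cycle : (e : Fin (suc (suc q)) → Bool → V) → DetourBound e →
    (∀ j → closing e j ≤ℚ closing e zero) → (s : Fin (suc q) → Bool) →
    ½ * ∑[ i < q ] closing e (suc (inject₁ i)) ≤ℚ ∑[ i < q ] link (e ∘ suc) s (inject₁ i) (suc i) →
    ∃[ t ] ½ * sum (closing e) ≤ℚ ∑[ j < suc (suc q) ] link e (t ∷ s) j (next j)
  extend-to-cycle {q} e detour closing≤c₀ s ½rest≤links = t , (begin
    ½ * (c₀ + ∑[ j < suc q ] closing e (suc j))  ≡⟨ cong (λ r → ½ * (c₀ + r))
                                                      (sum-init-last (closing e ∘ suc)) ⟩
    ½ * (c₀ + (rest + cₚ))                       ≤⟨ ℚₚ.*-monoˡ-≤-nonNeg ½
                                                      (ℚₚ.+-monoʳ-≤ c₀ (ℚₚ.+-monoʳ-≤ rest (closing≤c₀ _))) ⟩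
    ½ * (c₀ + (rest + c₀))                       ≡⟨ regroup c₀ rest ⟩
    ½ * (c₀ + c₀) + ½ * rest                     ≤⟨ ℚₚ.+-mono-≤ ½[c₀+c₀]≤joins ½rest≤links ⟩
    joins e zero x y t + links                   ≡⟨ swap (w (e zero t) y) (w x (e zero (not t))) links ⟩
    (w (e zero t) y + links) + w x (e zero (not t)) ≡⟨ sum-next (link e (t ∷ s)) ⟨
    ∑[ j < suc (suc q) ] link e (t ∷ s) j (next j) ∎)
    where
    open ℚₚ.≤-Reasoning
    open +-*-Solver
    c₀ cₚ rest links : ℚ
    c₀    = closing e zero
    cₚ    = closing e (fromℕ (suc q))
    rest  = ∑[ i < q ] closing e (suc (inject₁ i))
    links = ∑[ i < q ] link (e ∘ suc) s (inject₁ i) (suc i)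

    x y : V
    x = e (fromℕ (suc q)) (s (fromℕ q))
    y = e (suc zero) (not (s zero))

    best : ∃[ t ] ½ * (c₀ + c₀) ≤ℚ joins e zero x y t
    best = averaging (joins e zero x y) (joins-detour detour (λ ()) (λ ()) (not (s zero)) (s (fromℕ q)))
    t : Bool
    t = proj₁ best
    ½[c₀+c₀]≤joins : ½ * (c₀ + c₀) ≤ℚ joins e zero x y t
    ½[c₀+c₀]≤joins = proj₂ best

    regroup : ∀ a b → ½ * (a + (b + a)) ≡ ½ * (a + a) + ½ * b
    regroup = solve 2 (λ a b → con ½ :* (a :+ (b :+ a)) := con ½ :* (a :+ a) :+ con ½ :* b) refl
    swap : ∀ a b c → (a + b) + c ≡ (a + c) + b
    swap = solve 3 (λ a b c → (a :+ b) :+ c := (a :+ c) :+ b) refl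

  cyclic-orientation : (e : Fin (suc q) → Bool → V) → DetourBound e → 0ℚ ≤ℚ closing e zero →
                       (∀ j → closing e j ≤ℚ closing e zero) →
                       ∃[ s ] ½ * sum (closing e) ≤ℚ ∑[ j < suc q ] link e s j (next j)
  cyclic-orientation {zero}  e _      0≤c₀ _ =
    (λ _ → true) , ½*-≤-self (subst (0ℚ ≤ℚ_) (sym (ℚₚ.+-identityʳ (closing e zero))) 0≤c₀)
  cyclic-orientation {suc q} e detour _ closing≤c₀ =
    let (s , ½rest≤links) = chain-orientation (e ∘ suc) (DetourBound-suc detour)
        (t , bound)       = extend-to-cycle e detour closing≤c₀ s ½rest≤links
    in t ∷ s , bound

module _ (w : A → A → ℚ) (w-sym : ∀ a b → w a b ≡ w b a) where
  open Orientation w w-sym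

  cycleWeight-orient : (C : CycleCover (suc p) (suc n) A) (s : Fin (suc p) → Bool) →
    cycleWeight w (concat (cycle (rotateEach (orient ∘ s) C)))
      ≡ ∑[ j < suc p ] pathWeight w (cycle C j) + ∑[ j < suc p ] link (ends C) s j (next j)
  cycleWeight-orient {p} {n} C s = begin
    cycleWeight w (concat (cycle C′))
      ≡⟨ cycleWeight-concat w (cycle C′) ⟩
    ∑[ j < suc p ] (pathWeight w (cycle C′ j) + w (cycle C′ j (fromℕ n)) (cycle C′ (next j) zero))
      ≡⟨ sum-cong-≗ (λ j → cong₂ _+_ (pathWeight-orient w w-sym (s j) (cycle C j))
                                     (cong₂ w (cong (cycle C j) (orient-fromℕ (s j)))
                                              (cong (cycle C (next j)) (orient-zero (s (next j)))))) ⟩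
    ∑[ j < suc p ] (pathWeight w (cycle C j) + link (ends C) s j (next j))
      ≡⟨ ∑-distrib-+ (pathWeight w ∘ cycle C) (λ j → link (ends C) s j (next j)) ⟩
    ∑[ j < suc p ] pathWeight w (cycle C j) + ∑[ j < suc p ] link (ends C) s j (next j) ∎
    where
    open ≡-Reasoning
    C′ : CycleCover (suc p) (suc n) A
    C′ = rotateEach (orient ∘ s) C

-- Metric graphs

module _ {n : ℕ} {w : Weight n} (metric : IsMetric w) where
  open IsMetric metric
  open Orientation w symmetric

  detour : ∀ {a v b} → a ≢ v → v ≢ b → a ≢ b → w a b ≤ℚ w a v + w b v
  detour {a} {v} {b} a≢v v≢b a≢b =
    ℚₚ.≤-trans (triangle a v b a≢v v≢b a≢b) (ℚₚ.≤-reflexive (cong (_+_ (w a v)) (symmetric v b)))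

  module _ (C : CycleCover q (suc (suc m)) (Fin n)) where

    ends-apart : ∀ j → ends C j true ≢ ends C j false
    ends-apart j = 0≢1+n ∘ sym ∘ ,-injectiveʳ ∘ Bijection.injective C

    ends-detour : DetourBound (ends C)
    ends-detour j≢j′ t = detour (j≢j′ ∘ ,-injectiveˡ ∘ Bijection.injective C)
                                (j≢j′ ∘ sym ∘ ,-injectiveˡ ∘ Bijection.injective C)
                                (ends-apart _)

  hamiltonian-from-normal-cover : (C : CycleCover (suc p) (suc (suc m)) (Fin n)) → IsNormal w C →
    Σ[ H ∈ Fin (suc p ℕ.* suc (suc m)) ⤖ Fin n ]
      (1ℚ - ½ * (+ 1 / suc (suc m))) * coverWeight w C ≤ℚ cycleWeight w (Bijection.to H)
  hamiltonian-from-normal-cover {p} {m} C normal =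
    let (s , ½closings≤links) = cyclic-orientation (ends C) (ends-detour C) (nonneg _ _ (ends-apart C zero))
                                                   closing-heaviest-first
    in concatenate (rotateEach (orient ∘ s) C) , (begin
      (1ℚ - ½ * κ) * coverWeight w C                     ≡⟨ cong ((1ℚ - ½ * κ) *_) split ⟩
      (1ℚ - ½ * κ) * (paths + closings)                  ≤⟨ half-loss-bound {paths} {closings} {κ} closings≤ ⟩
      paths + ½ * closings                               ≤⟨ ℚₚ.+-monoʳ-≤ paths ½closings≤links ⟩
      paths + ∑[ j < suc p ] link (ends C) s j (next j)  ≡⟨ cycleWeight-orient w symmetric C s ⟨
      cycleWeight w (concat (cycle (rotateEach (orient ∘ s) C))) ∎)
    where
    open IsNormal normal
    open ℚₚ.≤-Reasoning
    κ paths closings : ℚ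
    κ        = + 1 / suc (suc m)
    paths    = ∑[ j < suc p ] pathWeight w (cycle C j)
    closings = ∑[ j < suc p ] closingWeight w (cycle C j)

    split : coverWeight w C ≡ paths + closings
    split = trans (sum-cong-≗ (cycleWeight-split w ∘ cycle C))
                  (∑-distrib-+ (pathWeight w ∘ cycle C) (closingWeight w ∘ cycle C))

    closings≤ : closings ≤ℚ κ * (paths + closings)
    closings≤ = begin
      closings                                        ≤⟨ sum-mono-≤ (λ j → ≤-mean (edgeWeight w (cycle C j))
                                                                                  (closing-lightest j)) ⟩
      ∑[ j < suc p ] (κ * cycleWeight w (cycle C j))  ≡⟨ *-distribˡ-sum κ (cycleWeight w ∘ cycle C) ⟨
      κ * coverWeight w C                             ≡⟨ cong (κ *_) split ⟩
      κ * (paths + closings)                          ∎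

  hamiltonian-from-cover : (C : CycleCover q (suc (suc m)) (Fin n)) →
    Σ[ H ∈ Fin (q ℕ.* suc (suc m)) ⤖ Fin n ]
      (1ℚ - ½ * (+ 1 / suc (suc m))) * coverWeight w C ≤ℚ cycleWeight w (Bijection.to H)
  hamiltonian-from-cover {zero}  {m} C =
    concatenate C , ℚₚ.≤-reflexive (ℚₚ.*-zeroʳ (1ℚ - ½ * (+ 1 / suc (suc m))))
  hamiltonian-from-cover {suc p} {m} C =
    let (C′ , same , normal) = normalise w C
        (H , bound)          = hamiltonian-from-normal-cover C′ normal
    in H , subst (λ P → (1ℚ - ½ * (+ 1 / suc (suc m))) * P ≤ℚ cycleWeight w (Bijection.to H)) same bound

-- The bound holds for every packing.
mainTheorem13 : (n k : ℕ) → .{{_ : NonZero k}} → 3 ≤ k → (k∣n : k ∣ n) →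
    (w : Weight n) → IsMetric w →
    (Hstar : HamCycle n) → (∀ (H : HamCycle n) → hamWeight w H ≤ℚ hamWeight w Hstar) →
    (Cstar : Packing n k k∣n) → (∀ (C : Packing n k k∣n) → packWeight k∣n w C ≤ℚ packWeight k∣n w Cstar) →
    (1ℚ - ½ * (+ 1 / k)) * packWeight k∣n w Cstar ≤ℚ hamWeight w Hstar
mainTheorem13 _ k (s≤s (s≤s _)) (divides q refl) w metric Hstar Hstar-max Cstar _ =
  let (H , bound) = hamiltonian-from-cover metric Cstar in begin
  (1ℚ - ½ * κ) * packWeight (divides q refl) w Cstar  ≡⟨ cong ((1ℚ - ½ * κ) *_) packWeight≡coverWeight ⟩
  (1ℚ - ½ * κ) * coverWeight w Cstar                  ≤⟨ bound ⟩
  cycleWeight w (Bijection.to H)                      ≡⟨ Σ≡sum (edgeWeight w (Bijection.to H)) ⟨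
  hamWeight w H                                       ≤⟨ Hstar-max H ⟩
  hamWeight w Hstar                                   ∎
  where
  open ℚₚ.≤-Reasoning
  κ : ℚ
  κ = + 1 / k
  packWeight≡coverWeight : packWeight (divides q refl) w Cstar ≡ coverWeight w Cstar
  packWeight≡coverWeight = trans (Σ≡sum (λ j → Σ (edgeWeight w (cycle Cstar j))))
                                 (sum-cong-≗ (Σ≡sum ∘ edgeWeight w ∘ cycle Cstar))
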